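{- Let $\gamma>0$ be fixed and put $c=\lceil\gamma\rceil$. There is no online bin packing algorithm with migration factor $\gamma$ (even if only insertions of items occur, and regardless of its running time) whose asymptotic approximation (competitive) ratio is better than $1+\frac{1}{6c+5}$.
   Context: Bin packing: items $i$ have sizes $s(i)\in(0,1]$ and must be partitioned into bins of capacity $1$; $\mathrm{OPT}(J)$ denotes the minimum number of bins for an item set $J$. In the online model with repacking, items $i_1,i_2,\dots$ arrive one at a time; at time $t$ the algorithm must produce a packing of $I(t)=\{i_1,\dots,i_t\}$ extending the previous one, and it may move (repack) previously packed items. The algorithm has migration factor $\gamma$ if at every time $t$ the total size of the items whose bin assignment changes at time $t$ is at most $\gamma\cdot s(i_t)$. Writing $A(I(t))$ for the number of bins used by algorithm $A$ at time $t$, $A$ has asymptotic approximation ratio at most $\alpha$ if there is a function $f\in o(\mathrm{OPT})$ with $A(I(t))\le \alpha\,\mathrm{OPT}(I(t))+f(I(t))$ for all input sequences $I$ and all $t$; the asymptotic approximation ratio is the minimum such $\alpha$.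
   Formalization: The migration factor γ ranges over the positive rationals, and the item sizes, the function f and the ratio α are taken in ℚ. -}

module Defs where

open import Data.Nat as ℕ using (ℕ; zero; suc)
open import Data.Fin using (Fin; toℕ; inject₁; fromℕ)
import Data.Fin as Fin
open import Data.Integer as ℤ using (ℤ; +_)
open import Data.Rational using (ℚ; 0ℚ; 1ℚ; _+_; _*_; _≤_; _<_; ∣_∣; ceiling; _/_)
open import Data.List using (List; length; map; allFin; deduplicate)
open import Data.Product using (Σ; ∃; _×_)
open import Data.Bool using (if_then_else_)
open import Relation.Nullary.Decidable using (⌊_⌋)

ℕ→ℚ : ℕ → ℚ
ℕ→ℚ n = + n / 1

sumFin : (t : ℕ) → (Fin t → ℚ) → ℚ
sumFin zero    x = 0ℚ
sumFin (suc t) x = x Fin.zero + sumFin t (λ j → x (Fin.suc j))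

ValidSizes : (t : ℕ) → (Fin t → ℚ) → Set
ValidSizes t x = (j : Fin t) → (0ℚ < x j) × (x j ≤ 1ℚ)

Assignment : ℕ → Set
Assignment t = Fin t → ℕ

load : (t : ℕ) → (Fin t → ℚ) → Assignment t → ℕ → ℚ
load t x σ b = sumFin t (λ j → if ⌊ σ j ℕ.≟ b ⌋ then x j else 0ℚ)

Feasible : (t : ℕ) → (Fin t → ℚ) → Assignment t → Set
Feasible t x σ = (b : ℕ) → load t x σ b ≤ 1ℚ

binsUsed : (t : ℕ) → Assignment t → ℕ
binsUsed t σ = length (deduplicate ℕ._≟_ (map σ (allFin t)))

PackableIn : (t : ℕ) → (Fin t → ℚ) → ℕ → Set
PackableIn t x k = Σ (Fin t → Fin k) λ σ → (b : ℕ) → load t x (λ j → toℕ (σ j)) b ≤ 1ℚ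

IsOPT : (t : ℕ) → (Fin t → ℚ) → ℕ → Set
IsOPT t x k = PackableIn t x k × ((k′ : ℕ) → PackableIn t x k′ → k ℕ.≤ k′)

-- An input sequence i_1, i_2, … given by its sizes (item i_{n+1} has size s n).
InputSeq : Set
InputSeq = ℕ → ℚ

ValidInput : InputSeq → Set
ValidInput s = (n : ℕ) → (0ℚ < s n) × (s n ≤ 1ℚ)

prefix : (t : ℕ) → InputSeq → Fin t → ℚ
prefix t s j = s (toℕ j)

-- A deterministic online algorithm (arbitrary running time): at time t it sees
-- the sizes of the first t items and outputs a bin assignment for them.
Algorithm : Set
Algorithm = (t : ℕ) → (Fin t → ℚ) → Assignment t

packingAt : Algorithm → InputSeq → (t : ℕ) → Assignment t
packingAt A s t = A t (prefix t s)

migrated : Algorithm → InputSeq → ℕ → ℚ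
migrated A s t =
  sumFin t (λ j → if ⌊ packingAt A s (suc t) (inject₁ j) ℕ.≟ packingAt A s t j ⌋
                   then 0ℚ else s (toℕ j))

HasMigrationFactor : Algorithm → ℚ → Set
HasMigrationFactor A γ =
  (s : InputSeq) → ValidInput s →
    ((t : ℕ) → Feasible t (prefix t s) (packingAt A s t)) ×
    ((t : ℕ) → migrated A s t ≤ γ * s t)

LittleOOPT : ((t : ℕ) → (Fin t → ℚ) → ℚ) → Set
LittleOOPT f =
  (ε : ℚ) → 0ℚ < ε → ∃ λ (N : ℕ) →
    (t : ℕ) (x : Fin t → ℚ) → ValidSizes t x → (k : ℕ) → IsOPT t x k →
    N ℕ.≤ k → ∣ f t x ∣ ≤ ε * ℕ→ℚ k

AsymRatioAtMost : Algorithm → ℚ → Set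
AsymRatioAtMost A α =
  Σ ((t : ℕ) → (Fin t → ℚ) → ℚ) λ f → LittleOOPT f ×
    ((s : InputSeq) → ValidInput s → (t : ℕ) → (k : ℕ) → IsOPT t (prefix t s) k →
      ℕ→ℚ (binsUsed t (packingAt A s t)) ≤ α * ℕ→ℚ k + f t (prefix t s))

ceilℕ : ℚ → ℕ
ceilℕ γ = ℤ.∣ ceiling γ ∣

lowerBound : ℚ → ℚ
lowerBound γ = 1ℚ + (+ 1 / (5 ℕ.+ 6 ℕ.* ceilℕ γ))

module Submission where

-- Let c = ⌈γ⌉ and measure sizes in units of 1/L, L = 8(c+1)²: large items have
-- size A = (4c+3)(c+1) and small items size B = 4c+5.  Feed 2M large items
-- (OPT = M, two per bin) and then 2(c+1)M small ones (OPT = 2M, one large and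
-- c+1 small items per bin).  As γ·B ≤ c·B < A, moving one large item when a small
-- item arrives already exceeds the migration budget, so the large items stay in
-- the bins they occupy at time 2M.  Weigh large items c+1 and small items 1: a
-- feasible bin weighs at most 2c+2 (which also certifies both optima), and at
-- most 2c+1 if it holds no large item.  The total weight 4(c+1)M then gives
-- (2c+1)·bins(end) + bins(2M) ≥ 4(c+1)M, so the ratio is at least
-- 1 + 1/(4c+3), which exceeds 1 + 1/(6c+5).

open import Defs
open import Data.Nat as ℕ
  using (ℕ; zero; suc; _+_; _*_; _≤_; _<_; z≤n; s≤s; z<s; s≤s⁻¹; _≟_; _<?_; NonZero)
open import Data.Nat.Properties
import Data.Nat.Tactic.RingSolver as ℕ-Solver
import Data.Integer.Tactic.RingSolver as ℤ-Solver
open import Data.Fin as Fin using (Fin; toℕ)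
open import Data.Fin.Properties using (toℕ<n; toℕ-inject₁; toℕ-fromℕ<; toℕ-injective)
open import Data.Nat.DivMod using (_%_; m%n<n; m<n⇒m%n≡m; [m+n]%n≡m%n)
open import Data.Bool using (if_then_else_)
open import Data.List using (List; []; _∷_; map; length; filter; _++_; allFin; deduplicate)
open import Data.Nat.ListAction using (sum)
open import Data.List.Properties using (length-++; length-map; length-tabulate)
open import Data.List.Membership.Propositional using (_∈_; _∉_)
open import Data.List.Membership.Propositional.Properties
  using (∈-∃++; ∈-++⁻; ∈-++⁺ˡ; ∈-++⁺ʳ; ∈-filter⁻; ∈-map⁺; ∈-allFin; ∈-deduplicate⁺)
open import Data.List.Membership.DecPropositional _≟_ using (_∈?_)
open import Data.List.Relation.Binary.Subset.Propositional using (_⊆_)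
open import Data.List.Relation.Unary.Any using (here; there)
open import Data.List.Relation.Unary.Unique.Propositional using (Unique; []; _∷_)
open import Data.List.Relation.Unary.Unique.Propositional.Properties using (filter⁺)
open import Data.List.Relation.Unary.Unique.DecPropositional.Properties _≟_ using (deduplicate-!)
import Data.List.Relation.Unary.All as All
open import Data.Product using (∃; _,_; proj₁; proj₂)
open import Data.Sum using (inj₁; inj₂)
open import Data.Empty using (⊥; ⊥-elim)
open import Relation.Nullary using (¬_; yes; no)
open import Relation.Nullary.Decidable using (⌊_⌋)
open import Relation.Binary.PropositionalEquality hiding ([_])
open import Function using (_∘_; id)
import Data.Integer as ℤ
import Data.Integer.Properties as ℤ
import Data.Integer.DivMod as ℤ
open import Data.Rational as ℚ using (ℚ; mkℚ; 0ℚ; 1ℚ; ↥_; ↧_; _/_)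
import Data.Rational.Properties as ℚ
import Data.Rational.Unnormalised as ℚᵘ
import Data.Rational.Unnormalised.Properties as ℚᵘ
import Data.Nat.Coprimality as Coprime
open import Data.Rational.Solver renaming (module +-*-Solver to ℚ-Solver)
open import Algebra.Properties.Semiring.Sum +-*-semiring
  using (sum-syntax; sum-cong-≗; ∑-distrib-+; *-distribʳ-sum)

∑-mono-≤ : ∀ {t} {f g : Fin t → ℕ} → (∀ j → f j ≤ g j) → ∑[ j < t ] f j ≤ ∑[ j < t ] g j
∑-mono-≤ {zero}  f≤g = z≤n
∑-mono-≤ {suc t} f≤g = +-mono-≤ (f≤g Fin.zero) (∑-mono-≤ (f≤g ∘ Fin.suc))

∑-const : ∀ t v → ∑[ j < t ] v ≡ t * v
∑-const zero    v = refl
∑-const (suc t) v = cong (v +_) (∑-const t v)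

∑-zero : ∀ {t} {f : Fin t → ℕ} → (∀ j → f j ≡ 0) → ∑[ j < t ] f j ≡ 0
∑-zero {t} f≡0 = trans (sum-cong-≗ f≡0) (trans (∑-const t 0) (*-zeroʳ t))

∑-split : ∀ m n (f : ℕ → ℕ) →
  ∑[ j < m + n ] f (toℕ j) ≡ ∑[ j < m ] f (toℕ j) + ∑[ j < n ] f (m + toℕ j)
∑-split zero    n f = refl
∑-split (suc m) n f = trans (cong (f 0 +_) (∑-split m n (f ∘ suc))) (sym (+-assoc (f 0) _ _))

∑-cong-< : ∀ t {f g : ℕ → ℕ} → (∀ n → n < t → f n ≡ g n) →
  ∑[ j < t ] f (toℕ j) ≡ ∑[ j < t ] g (toℕ j)
∑-cong-< t f≡g = sum-cong-≗ (λ j → f≡g (toℕ j) (toℕ<n j))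

select : ℕ → ℕ → ℕ → ℕ
select a b w = if ⌊ a ≟ b ⌋ then w else 0

loadℕ : (t : ℕ) → (Fin t → ℕ) → Assignment t → ℕ → ℕ
loadℕ t w σ b = ∑[ j < t ] select (σ j) b (w j)

select-zero : ∀ a b → select a b 0 ≡ 0
select-zero a b with a ≟ b
... | yes _ = refl
... | no  _ = refl

select-suc : ∀ a b w → select (suc a) (suc b) w ≡ select a b w
select-suc a b w with suc a ≟ suc b | a ≟ b
... | yes _     | yes _   = refl
... | no  _     | no  _   = refl
... | yes 1+a≡1+b | no a≢b = ⊥-elim (a≢b (suc-injective 1+a≡1+b))
... | no  1+a≢1+b | yes a≡b = ⊥-elim (1+a≢1+b (cong suc a≡b))

loadℕ-linear : ∀ {t} {w u v : Fin t → ℕ} p q σ b → (∀ j → w j ≡ u j * p + v j * q) →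
  loadℕ t w σ b ≡ loadℕ t u σ b * p + loadℕ t v σ b * q
loadℕ-linear {t} {w} {u} {v} p q σ b w≡ = begin
  ∑[ j < t ] select (σ j) b (w j)
    ≡⟨ sum-cong-≗ (λ j → select-linear (σ j) (w≡ j)) ⟩
  ∑[ j < t ] (select (σ j) b (u j) * p + select (σ j) b (v j) * q)
    ≡⟨ ∑-distrib-+ (λ j → select (σ j) b (u j) * p) (λ j → select (σ j) b (v j) * q) ⟩
  ∑[ j < t ] (select (σ j) b (u j) * p) + ∑[ j < t ] (select (σ j) b (v j) * q)
    ≡⟨ sym (cong₂ _+_ (*-distribʳ-sum p (λ j → select (σ j) b (u j))) (*-distribʳ-sum q (λ j → select (σ j) b (v j)))) ⟩
  loadℕ t u σ b * p + loadℕ t v σ b * q ∎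
  where
  open ≡-Reasoning
  select-linear : ∀ a {x y z} → x ≡ y * p + z * q → select a b x ≡ select a b y * p + select a b z * q
  select-linear a x≡ with a ≟ b
  ... | yes _ = x≡
  ... | no  _ = refl

loadℕ-zero : ∀ {t} (w : Fin t → ℕ) σ b → (∀ j → w j ≢ 0 → σ j ≢ b) → loadℕ t w σ b ≡ 0
loadℕ-zero w σ b apart = ∑-zero (λ j → zero-term (σ j) (w j) (apart j))
  where
  zero-term : ∀ a x → (x ≢ 0 → a ≢ b) → select a b x ≡ 0
  zero-term a x apart with a ≟ b | x ≟ 0
  ... | no  _   | _       = refl
  ... | yes _   | yes x≡0 = x≡0
  ... | yes a≡b | no  x≢0 = ⊥-elim (apart x≢0 a≡b)

∑-select-toℕ≤ : ∀ n b w → ∑[ j < n ] select (toℕ j) b w ≤ w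
∑-select-toℕ≤ zero    b       w = z≤n
∑-select-toℕ≤ (suc n) zero    w = ≤-reflexive (trans (cong (w +_) (∑-zero {n} (λ _ → refl))) (+-identityʳ w))
∑-select-toℕ≤ (suc n) (suc b) w = begin
  ∑[ j < n ] select (suc (toℕ j)) (suc b) w ≡⟨ sum-cong-≗ {n} (λ j → select-suc (toℕ j) b w) ⟩
  ∑[ j < n ] select (toℕ j) b w             ≤⟨ ∑-select-toℕ≤ n b w ⟩
  w                                        ∎
  where open ≤-Reasoning

∑-select-%≤ : ∀ m .{{_ : NonZero m}} b w → ∑[ j < m ] select (toℕ j % m) b w ≤ w
∑-select-%≤ m b w = begin
  ∑[ j < m ] select (toℕ j % m) b w ≡⟨ ∑-cong-< m (λ n n<m → cong (λ r → select r b w) (m<n⇒m%n≡m n<m)) ⟩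
  ∑[ j < m ] select (toℕ j) b w     ≤⟨ ∑-select-toℕ≤ m b w ⟩
  w                                 ∎
  where open ≤-Reasoning

∑-select-+%≡ : ∀ n m .{{_ : NonZero m}} b w →
  ∑[ j < n ] select ((m + toℕ j) % m) b w ≡ ∑[ j < n ] select (toℕ j % m) b w
∑-select-+%≡ n m b w = sum-cong-≗ {n} (λ j → cong (λ r → select r b w)
  (trans (cong (_% m) (+-comm m (toℕ j))) ([m+n]%n≡m%n (toℕ j) m)))

∑-select-mod≤ : ∀ q m .{{_ : NonZero m}} b w → ∑[ j < q * m ] select (toℕ j % m) b w ≤ q * w
∑-select-mod≤ zero    m b w = z≤n
∑-select-mod≤ (suc q) m b w = begin
  ∑[ j < m + q * m ] select (toℕ j % m) b w
    ≡⟨ ∑-split m (q * m) (λ n → select (n % m) b w) ⟩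
  ∑[ j < m ] select (toℕ j % m) b w + ∑[ j < q * m ] select ((m + toℕ j) % m) b w
    ≡⟨ cong (∑[ j < m ] select (toℕ j % m) b w +_) (∑-select-+%≡ (q * m) m b w) ⟩
  ∑[ j < m ] select (toℕ j % m) b w + ∑[ j < q * m ] select (toℕ j % m) b w
    ≤⟨ +-mono-≤ (∑-select-%≤ m b w) (∑-select-mod≤ q m b w) ⟩
  w + q * w ∎
  where open ≤-Reasoning

∑≤∑capacity : ∀ {t} (w : Fin t → ℕ) (σ : Assignment t) (cap : ℕ → ℕ) (D : List ℕ) →
  (∀ j → w j ≢ 0 → σ j ∈ D) → (∀ b → loadℕ t w σ b ≤ cap b) →
  ∑[ j < t ] w j ≤ sum (map cap D)
∑≤∑capacity {t} w σ cap [] covered _ = ≤-reflexive (∑-zero w≡0)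
  where
  w≡0 : ∀ j → w j ≡ 0
  w≡0 j with w j ≟ 0
  ... | yes w≡0 = w≡0
  ... | no  w≢0 with () ← covered j w≢0
∑≤∑capacity {t} w σ cap (d ∷ D) covered load≤cap = begin
  ∑[ j < t ] w j
    ≡⟨ sum-cong-≗ (λ j → split (σ j) (w j)) ⟩
  ∑[ j < t ] (select (σ j) d (w j) + w′ j)
    ≡⟨ ∑-distrib-+ (λ j → select (σ j) d (w j)) w′ ⟩
  loadℕ t w σ d + ∑[ j < t ] w′ j
    ≤⟨ +-mono-≤ (load≤cap d) (∑≤∑capacity w′ σ cap D covered′ load′≤cap) ⟩
  cap d + sum (map cap D) ∎
  where
  open ≤-Reasoning
  w′ : Fin _ → ℕ
  w′ j = if ⌊ σ j ≟ d ⌋ then 0 else w j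
  split : ∀ a x → x ≡ select a d x + (if ⌊ a ≟ d ⌋ then 0 else x)
  split a x with a ≟ d
  ... | yes _ = sym (+-identityʳ x)
  ... | no  _ = refl
  covered′ : ∀ j → w′ j ≢ 0 → σ j ∈ D
  covered′ j w′≢0 with σ j ≟ d
  ... | yes _   = ⊥-elim (w′≢0 refl)
  ... | no  σ≢d with covered j w′≢0
  ...   | here σ≡d = ⊥-elim (σ≢d σ≡d)
  ...   | there σ∈D = σ∈D
  load′≤cap : ∀ b → loadℕ t w′ σ b ≤ cap b
  load′≤cap b = ≤-trans (∑-mono-≤ (λ j → select-mono (σ j) (w j))) (load≤cap b)
    where
    select-mono : ∀ a x → select a b (if ⌊ a ≟ d ⌋ then 0 else x) ≤ select a b x
    select-mono a x with a ≟ d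
    ... | yes _ = subst (_≤ select a b x) (sym (select-zero a b)) z≤n
    ... | no  _ = ≤-refl

∑≤bins*capacity : ∀ {t k} (w : Fin t → ℕ) (σ : Fin t → Fin k) v →
  (∀ b → loadℕ t w (toℕ ∘ σ) b ≤ v) → ∑[ j < t ] w j ≤ k * v
∑≤bins*capacity {t} {k} w σ v load≤v = begin
  ∑[ j < t ] w j
    ≤⟨ ∑≤∑capacity w (toℕ ∘ σ) (λ _ → v) labels (λ j _ → ∈-map⁺ toℕ (∈-allFin (σ j))) load≤v ⟩
  sum (map (λ _ → v) labels)
    ≡⟨ sum-map-const labels ⟩
  length labels * v
    ≡⟨ cong (_* v) (trans (length-map toℕ (allFin k)) (length-tabulate {n = k} id)) ⟩
  k * v ∎
  where
  open ≤-Reasoning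
  labels : List ℕ
  labels = map toℕ (allFin k)
  sum-map-const : ∀ (xs : List ℕ) → sum (map (λ _ → v) xs) ≡ length xs * v
  sum-map-const []       = refl
  sum-map-const (_ ∷ xs) = cong (v +_) (sum-map-const xs)

unique-⊆⇒length≤ : ∀ {xs ys : List ℕ} → Unique xs → xs ⊆ ys → length xs ≤ length ys
unique-⊆⇒length≤ {[]}     _             _       = z≤n
unique-⊆⇒length≤ {x ∷ xs} (x∉xs ∷ !xs) xxs⊆ys with ∈-∃++ (xxs⊆ys (here refl))
... | us , vs , refl = begin
  suc (length xs)         ≤⟨ s≤s (unique-⊆⇒length≤ !xs xs⊆us++vs) ⟩
  suc (length (us ++ vs)) ≡⟨ cong suc (length-++ us) ⟩
  suc (length us + length vs) ≡⟨ sym (+-suc (length us) (length vs)) ⟩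
  length us + length (x ∷ vs) ≡⟨ sym (length-++ us) ⟩
  length (us ++ x ∷ vs)   ∎
  where
  open ≤-Reasoning
  xs⊆us++vs : xs ⊆ us ++ vs
  xs⊆us++vs {y} y∈xs with ∈-++⁻ us (xxs⊆ys (there y∈xs))
  ... | inj₁ y∈us          = ∈-++⁺ˡ y∈us
  ... | inj₂ (here y≡x)    = ⊥-elim (All.lookup x∉xs y∈xs (sym y≡x))
  ... | inj₂ (there y∈vs)  = ∈-++⁺ʳ us y∈vs

usedBins : (t : ℕ) → Assignment t → List ℕ
usedBins t σ = deduplicate _≟_ (map σ (allFin t))

∈-usedBins : ∀ {t} (σ : Assignment t) j → σ j ∈ usedBins t σ
∈-usedBins σ j = ∈-deduplicate⁺ _≟_ (∈-map⁺ σ (∈-allFin j))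

[_∈_] : ℕ → List ℕ → ℕ
[ b ∈ E ] = if ⌊ b ∈? E ⌋ then 1 else 0

≤-+-[∈] : ∀ {x K} (E : List ℕ) b → x ≤ K + 1 → (b ∉ E → x ≤ K) → x ≤ K + [ b ∈ E ]
≤-+-[∈] {x} {K} E b x≤K+1 x≤K with b ∈? E
... | yes _   = x≤K+1
... | no  b∉E = ≤-trans (x≤K b∉E) (m≤m+n K 0)

∑capacity≤ : ∀ K (E D : List ℕ) → Unique D →
  sum (map (λ b → K + [ b ∈ E ]) D) ≤ K * length D + length E
∑capacity≤ K E D !D = begin
  sum (map (λ b → K + [ b ∈ E ]) D)
    ≡⟨ ∑capacity≡ D ⟩
  K * length D + length (filter (_∈? E) D)
    ≤⟨ +-monoʳ-≤ (K * length D) (unique-⊆⇒length≤ (filter⁺ (_∈? E) !D) (λ b∈ → proj₂ (∈-filter⁻ (_∈? E) {xs = D} b∈))) ⟩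
  K * length D + length E ∎
  where
  open ≤-Reasoning
  shift : ∀ K x F e → K + e + (x + F) ≡ K + x + (e + F)
  shift = ℕ-Solver.solve-∀
  ∑capacity≡ : ∀ D → sum (map (λ b → K + [ b ∈ E ]) D) ≡ K * length D + length (filter (_∈? E) D)
  ∑capacity≡ [] = sym (trans (+-identityʳ (K * 0)) (*-zeroʳ K))
  ∑capacity≡ (d ∷ D) rewrite *-suc K (length D) with d ∈? E
  ... | yes _ = trans (cong (K + 1 +_) (∑capacity≡ D)) (shift K (K * length D) _ 1)
  ... | no  _ = trans (cong (K + 0 +_) (∑capacity≡ D)) (shift K (K * length D) _ 0)

private
  ℕ→ℚ≡mkℚ : ∀ n → ℕ→ℚ n ≡ mkℚ (ℤ.+ n) 0 (Coprime.sym (Coprime.1-coprimeTo n))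
  ℕ→ℚ≡mkℚ n = ℚ.↥p/↧p≡p _

  toℚᵘ-ℕ→ℚ : ∀ n → ℚ.toℚᵘ (ℕ→ℚ n) ≡ ℚᵘ.mkℚᵘ (ℤ.+ n) 0
  toℚᵘ-ℕ→ℚ n = cong ℚ.toℚᵘ (ℕ→ℚ≡mkℚ n)

ℕ→ℚ-+ : ∀ m n → ℕ→ℚ (m ℕ.+ n) ≡ ℕ→ℚ m ℚ.+ ℕ→ℚ n
ℕ→ℚ-+ m n = ℚ.toℚᵘ-injective (begin
  ℚ.toℚᵘ (ℕ→ℚ (m ℕ.+ n))                  ≡⟨ toℚᵘ-ℕ→ℚ (m ℕ.+ n) ⟩
  ℚᵘ.mkℚᵘ (ℤ.+ (m ℕ.+ n)) 0                  ≈⟨ ℚᵘ.*≡* (trans (cong (ℤ._* ℤ.+ 1) (ℤ.pos-+ m n)) (distrib (ℤ.+ m) (ℤ.+ n))) ⟩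
  ℚᵘ.mkℚᵘ (ℤ.+ m) 0 ℚᵘ.+ ℚᵘ.mkℚᵘ (ℤ.+ n) 0     ≡⟨ sym (cong₂ ℚᵘ._+_ (toℚᵘ-ℕ→ℚ m) (toℚᵘ-ℕ→ℚ n)) ⟩
  ℚ.toℚᵘ (ℕ→ℚ m) ℚᵘ.+ ℚ.toℚᵘ (ℕ→ℚ n)      ≈⟨ ℚᵘ.≃-sym (ℚ.toℚᵘ-homo-+ (ℕ→ℚ m) (ℕ→ℚ n)) ⟩
  ℚ.toℚᵘ (ℕ→ℚ m ℚ.+ ℕ→ℚ n)                ∎)
  where
  open ℚᵘ.≃-Reasoning
  distrib : ∀ a b → (a ℤ.+ b) ℤ.* ℤ.+ 1 ≡ (a ℤ.* ℤ.+ 1 ℤ.+ b ℤ.* ℤ.+ 1) ℤ.* ℤ.+ 1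
  distrib = ℤ-Solver.solve-∀

ℕ→ℚ-* : ∀ m n → ℕ→ℚ (m ℕ.* n) ≡ ℕ→ℚ m ℚ.* ℕ→ℚ n
ℕ→ℚ-* m n = ℚ.toℚᵘ-injective (begin
  ℚ.toℚᵘ (ℕ→ℚ (m ℕ.* n))                  ≡⟨ toℚᵘ-ℕ→ℚ (m ℕ.* n) ⟩
  ℚᵘ.mkℚᵘ (ℤ.+ (m ℕ.* n)) 0                  ≈⟨ ℚᵘ.*≡* (cong (ℤ._* ℤ.+ 1) (ℤ.pos-* m n)) ⟩
  ℚᵘ.mkℚᵘ (ℤ.+ m) 0 ℚᵘ.* ℚᵘ.mkℚᵘ (ℤ.+ n) 0     ≡⟨ sym (cong₂ ℚᵘ._*_ (toℚᵘ-ℕ→ℚ m) (toℚᵘ-ℕ→ℚ n)) ⟩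
  ℚ.toℚᵘ (ℕ→ℚ m) ℚᵘ.* ℚ.toℚᵘ (ℕ→ℚ n)      ≈⟨ ℚᵘ.≃-sym (ℚ.toℚᵘ-homo-* (ℕ→ℚ m) (ℕ→ℚ n)) ⟩
  ℚ.toℚᵘ (ℕ→ℚ m ℚ.* ℕ→ℚ n)                ∎)
  where open ℚᵘ.≃-Reasoning

ℕ→ℚ-mono-≤ : ∀ {m n} → m ≤ n → ℕ→ℚ m ℚ.≤ ℕ→ℚ n
ℕ→ℚ-mono-≤ {m} {n} m≤n rewrite ℕ→ℚ≡mkℚ m | ℕ→ℚ≡mkℚ n =
  ℚ.*≤* (ℤ.*-monoʳ-≤-nonNeg (ℤ.+ 1) (ℤ.+≤+ m≤n))

ℕ→ℚ-cancel-≤ : ∀ {m n} → ℕ→ℚ m ℚ.≤ ℕ→ℚ n → m ≤ n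
ℕ→ℚ-cancel-≤ {m} {n} rewrite ℕ→ℚ≡mkℚ m | ℕ→ℚ≡mkℚ n =
  λ { (ℚ.*≤* m≤n) → ℤ.drop‿+≤+ (ℤ.*-cancelʳ-≤-pos (ℤ.+ m) (ℤ.+ n) (ℤ.+ 1) m≤n) }

ℕ→ℚ-mono-< : ∀ {m n} → m < n → ℕ→ℚ m ℚ.< ℕ→ℚ n
ℕ→ℚ-mono-< {m} {n} m<n rewrite ℕ→ℚ≡mkℚ m | ℕ→ℚ≡mkℚ n =
  ℚ.*<* (ℤ.*-monoʳ-<-pos (ℤ.+ 1) (ℤ.+<+ m<n))

ℕ→ℚ-*-inverse : ∀ n .{{_ : NonZero n}} → ℕ→ℚ n ℚ.* (ℤ.+ 1 / n) ≡ 1ℚ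
ℕ→ℚ-*-inverse (suc k) = ℚ.toℚᵘ-injective (begin
  ℚ.toℚᵘ (ℕ→ℚ (suc k) ℚ.* (ℤ.+ 1 / suc k))
    ≈⟨ ℚ.toℚᵘ-homo-* (ℕ→ℚ (suc k)) (ℤ.+ 1 / suc k) ⟩
  ℚ.toℚᵘ (ℕ→ℚ (suc k)) ℚᵘ.* ℚ.toℚᵘ (ℤ.+ 1 / suc k)
    ≡⟨ cong₂ ℚᵘ._*_ (toℚᵘ-ℕ→ℚ (suc k)) (cong ℚ.toℚᵘ (ℚ.↥p/↧p≡p (mkℚ (ℤ.+ 1) k (Coprime.1-coprimeTo (suc k))))) ⟩
  ℚᵘ.mkℚᵘ (ℤ.+ suc k) 0 ℚᵘ.* ℚᵘ.mkℚᵘ (ℤ.+ 1) k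
    ≈⟨ ℚᵘ.*≡* (trans (ℤ.*-identityʳ _) (trans (ℤ.*-identityʳ _) (sym (trans (ℤ.*-identityˡ _) (cong ℤ.+_ (*-identityˡ (suc k))))))) ⟩
  ℚᵘ.1ℚᵘ ∎)
  where open ℚᵘ.≃-Reasoning

1/n-pos : ∀ n .{{_ : NonZero n}} → 0ℚ ℚ.< ℤ.+ 1 / n
1/n-pos n = ℚ.positive⁻¹ (ℤ.+ 1 / n) {{ℚ.normalize-pos 1 n}}

-- The library defines ⌈γ⌉ as -⌊-γ⌋.
≤ceilℕ : ∀ γ → γ ℚ.≤ ℕ→ℚ (ceilℕ γ)
≤ceilℕ γ@(mkℚ n d-1 _) rewrite ℕ→ℚ≡mkℚ (ceilℕ γ) =
  ℚ.*≤* (ℤ.≤-trans n≤⌈γ⌉*d (ℤ.*-monoʳ-≤-nonNeg (↧ γ) (i≤∣i∣ (ℚ.ceiling γ))))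
  where
  i≤∣i∣ : ∀ i → i ℤ.≤ ℤ.+ ℤ.∣ i ∣
  i≤∣i∣ (ℤ.+ _)      = ℤ.≤-refl
  i≤∣i∣ ℤ.-[1+ _ ] = ℤ.-≤+
  ⌊p⌋*↧p≤↥p : ∀ p → ℚ.floor p ℤ.* ↧ p ℤ.≤ ↥ p
  ⌊p⌋*↧p≤↥p p@record{} = ℤ.[n/d]*d≤n (↥ p) (↧ p)
  ⌊-γ⌋*d≤-n : ℚ.floor (ℚ.- γ) ℤ.* ↧ γ ℤ.≤ ℤ.- n
  ⌊-γ⌋*d≤-n = subst₂ (λ d m → ℚ.floor (ℚ.- γ) ℤ.* d ℤ.≤ m) (ℚ.↧-neg γ) (ℚ.↥-neg γ)
                (⌊p⌋*↧p≤↥p (ℚ.- γ))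
  n≤⌈γ⌉*d : n ℤ.* ℤ.+ 1 ℤ.≤ ℚ.ceiling γ ℤ.* ↧ γ
  n≤⌈γ⌉*d = subst₂ ℤ._≤_ (trans (ℤ.neg-involutive n) (sym (ℤ.*-identityʳ n)))
              (ℤ.neg-distribˡ-* (ℚ.floor (ℚ.- γ)) (↧ γ)) (ℤ.neg-mono-≤ ⌊-γ⌋*d≤-n)

ℕ→ℚ-nonNeg : ∀ n → ℚ.NonNegative (ℕ→ℚ n)
ℕ→ℚ-nonNeg n = ℚ.nonNegative (ℕ→ℚ-mono-≤ {0} {n} z≤n)

sumFin-cong : ∀ t {x y : Fin t → ℚ} → (∀ j → x j ≡ y j) → sumFin t x ≡ sumFin t y
sumFin-cong zero    x≡y = refl
sumFin-cong (suc t) x≡y = cong₂ ℚ._+_ (x≡y Fin.zero) (sumFin-cong t (x≡y ∘ Fin.suc))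

sumFin-ℕ→ℚ : ∀ t (w : Fin t → ℕ) r → sumFin t (λ j → ℕ→ℚ (w j) ℚ.* r) ≡ ℕ→ℚ (∑[ j < t ] w j) ℚ.* r
sumFin-ℕ→ℚ zero    w r = sym (ℚ.*-zeroˡ r)
sumFin-ℕ→ℚ (suc t) w r = begin
  ℕ→ℚ (w Fin.zero) ℚ.* r ℚ.+ sumFin t (λ j → ℕ→ℚ (w (Fin.suc j)) ℚ.* r)
    ≡⟨ cong (ℕ→ℚ (w Fin.zero) ℚ.* r ℚ.+_) (sumFin-ℕ→ℚ t (w ∘ Fin.suc) r) ⟩
  ℕ→ℚ (w Fin.zero) ℚ.* r ℚ.+ ℕ→ℚ (∑[ j < t ] w (Fin.suc j)) ℚ.* r
    ≡⟨ sym (ℚ.*-distribʳ-+ r (ℕ→ℚ (w Fin.zero)) (ℕ→ℚ (∑[ j < t ] w (Fin.suc j)))) ⟩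
  (ℕ→ℚ (w Fin.zero) ℚ.+ ℕ→ℚ (∑[ j < t ] w (Fin.suc j))) ℚ.* r
    ≡⟨ cong (ℚ._* r) (sym (ℕ→ℚ-+ (w Fin.zero) (∑[ j < t ] w (Fin.suc j)))) ⟩
  ℕ→ℚ (∑[ j < suc t ] w j) ℚ.* r ∎
  where open ≡-Reasoning

load-ℕ→ℚ : ∀ t (w : Fin t → ℕ) r σ b →
  load t (λ j → ℕ→ℚ (w j) ℚ.* r) σ b ≡ ℕ→ℚ (loadℕ t w σ b) ℚ.* r
load-ℕ→ℚ t w r σ b = trans (sumFin-cong t (λ j → select-ℕ→ℚ (σ j) (w j))) (sumFin-ℕ→ℚ t _ r)
  where
  select-ℕ→ℚ : ∀ a x → (if ⌊ a ℕ.≟ b ⌋ then ℕ→ℚ x ℚ.* r else 0ℚ) ≡ ℕ→ℚ (select a b x) ℚ.* r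
  select-ℕ→ℚ a x with a ℕ.≟ b
  ... | yes _ = refl
  ... | no  _ = sym (ℚ.*-zeroˡ r)

0≤sumFin : ∀ t {x : Fin t → ℚ} → (∀ j → 0ℚ ℚ.≤ x j) → 0ℚ ℚ.≤ sumFin t x
0≤sumFin zero    _   = ℚ.≤-refl
0≤sumFin (suc t) x≥0 = ℚ.+-mono-≤ (x≥0 Fin.zero) (0≤sumFin t (x≥0 ∘ Fin.suc))

x≤sumFin : ∀ t (x : Fin t → ℚ) → (∀ j → 0ℚ ℚ.≤ x j) → ∀ j → x j ℚ.≤ sumFin t x
x≤sumFin (suc t) x x≥0 Fin.zero =
  subst (ℚ._≤ sumFin (suc t) x) (ℚ.+-identityʳ (x Fin.zero)) (ℚ.+-monoʳ-≤ (x Fin.zero) (0≤sumFin t (x≥0 ∘ Fin.suc)))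
x≤sumFin (suc t) x x≥0 (Fin.suc j) =
  subst (ℚ._≤ sumFin (suc t) x) (ℚ.+-identityˡ (x (Fin.suc j))) (ℚ.+-mono-≤ (x≥0 Fin.zero) (x≤sumFin t (x ∘ Fin.suc) (x≥0 ∘ Fin.suc) j))

private
  1/n-nonNeg : ∀ n .{{_ : NonZero n}} → ℚ.NonNegative (ℤ.+ 1 / n)
  1/n-nonNeg n = ℚ.nonNegative (ℚ.<⇒≤ (1/n-pos n))

ℕ→ℚ*1/n≤1⇒≤ : ∀ n .{{_ : NonZero n}} {m} → ℕ→ℚ m ℚ.* (ℤ.+ 1 / n) ℚ.≤ 1ℚ → m ≤ n
ℕ→ℚ*1/n≤1⇒≤ n {m} m/n≤1 = ℕ→ℚ-cancel-≤ (ℚ.*-cancelʳ-≤-pos (ℤ.+ 1 / n) {{ℚ.positive (1/n-pos n)}}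
  (subst (ℕ→ℚ m ℚ.* (ℤ.+ 1 / n) ℚ.≤_) (sym (ℕ→ℚ-*-inverse n)) m/n≤1))

≤⇒ℕ→ℚ*1/n≤1 : ∀ n .{{_ : NonZero n}} {m} → m ≤ n → ℕ→ℚ m ℚ.* (ℤ.+ 1 / n) ℚ.≤ 1ℚ
≤⇒ℕ→ℚ*1/n≤1 n {m} m≤n = subst (ℕ→ℚ m ℚ.* (ℤ.+ 1 / n) ℚ.≤_) (ℕ→ℚ-*-inverse n)
  (ℚ.*-monoʳ-≤-nonNeg (ℤ.+ 1 / n) {{1/n-nonNeg n}} (ℕ→ℚ-mono-≤ m≤n))

packableIn-mod : ∀ t k .{{_ : NonZero k}} (x : Fin t → ℚ) →
  (∀ b → load t x (λ j → toℕ j % k) b ℚ.≤ 1ℚ) → PackableIn t x k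
packableIn-mod t k x load≤1 = σ , λ b → subst (ℚ._≤ 1ℚ) (same-load b) (load≤1 b)
  where
  σ : Fin t → Fin k
  σ j = Fin.fromℕ< (m%n<n (toℕ j) k)
  same-load : ∀ b → load t x (λ j → toℕ j % k) b ≡ load t x (toℕ ∘ σ) b
  same-load b = sumFin-cong t (λ j → cong (λ a → if ⌊ a ≟ b ⌋ then x j else 0ℚ) (sym (toℕ-fromℕ< _)))

embed : ∀ i {n} → Fin n → Fin (i + n)
embed zero    j = j
embed (suc i) j = Fin.inject₁ (embed i j)

toℕ-embed : ∀ i {n} (j : Fin n) → toℕ (embed i j) ≡ toℕ j
toℕ-embed zero    j = refl
toℕ-embed (suc i) j = trans (toℕ-inject₁ (embed i j)) (toℕ-embed i j)

module _ (A : Algorithm) {s : InputSeq} (valid : ValidInput s) where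

  moved⇒size≤migrated : ∀ {t} (j : Fin t) →
    packingAt A s (suc t) (Fin.inject₁ j) ≢ packingAt A s t j → s (toℕ j) ℚ.≤ migrated A s t
  moved⇒size≤migrated {t} j moved =
    subst (ℚ._≤ migrated A s t) (charged j moved) (x≤sumFin t _ 0≤charges j)
    where
    charged : ∀ j → packingAt A s (suc t) (Fin.inject₁ j) ≢ packingAt A s t j →
      (if ⌊ packingAt A s (suc t) (Fin.inject₁ j) ≟ packingAt A s t j ⌋ then 0ℚ else s (toℕ j)) ≡ s (toℕ j)
    charged j moved with packingAt A s (suc t) (Fin.inject₁ j) ≟ packingAt A s t j
    ... | yes stayed = ⊥-elim (moved stayed)
    ... | no  _      = refl
    0≤charge : ∀ a b x → 0ℚ ℚ.≤ x → 0ℚ ℚ.≤ (if ⌊ a ≟ b ⌋ then 0ℚ else x)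
    0≤charge a b x 0≤x with a ≟ b
    ... | yes _ = ℚ.≤-refl
    ... | no  _ = 0≤x
    0≤charges : ∀ k → 0ℚ ℚ.≤ (if ⌊ packingAt A s (suc t) (Fin.inject₁ k) ≟ packingAt A s t k ⌋ then 0ℚ else s (toℕ k))
    0≤charges k = 0≤charge (packingAt A s (suc t) (Fin.inject₁ k)) (packingAt A s t k) (s (toℕ k)) (ℚ.<⇒≤ (proj₁ (valid (toℕ k))))

  label-frozen : ∀ γ → (∀ t → migrated A s t ℚ.≤ γ ℚ.* s t) →
    ∀ {n} (j : Fin n) → (∀ i → γ ℚ.* s (i + n) ℚ.< s (toℕ j)) →
    ∀ i → packingAt A s (i + n) (embed i j) ≡ packingAt A s n j
  label-frozen γ migration j heavy zero    = refl
  label-frozen γ migration {n} j heavy (suc i)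
    with packingAt A s (suc i + n) (embed (suc i) j) ≟ packingAt A s (i + n) (embed i j)
  ... | yes stayed = trans stayed (label-frozen γ migration j heavy i)
  ... | no  moved  = ⊥-elim (ℚ.<-irrefl refl (begin-strict
    γ ℚ.* s (i + n)           <⟨ heavy i ⟩
    s (toℕ j)                 ≡⟨ cong s (sym (toℕ-embed i j)) ⟩
    s (toℕ (embed i j))       ≤⟨ moved⇒size≤migrated (embed i j) moved ⟩
    migrated A s (i + n)      ≤⟨ migration (i + n) ⟩
    γ ℚ.* s (i + n)           ∎))
    where open ℚ.≤-Reasoning

p≤∣p∣ : ∀ p → p ℚ.≤ ℚ.∣ p ∣
p≤∣p∣ p with ℚ.≤-total 0ℚ p
... | inj₁ 0≤p = ℚ.≤-reflexive (sym (ℚ.0≤p⇒∣p∣≡p 0≤p))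
... | inj₂ p≤0 = ℚ.≤-trans p≤0 (ℚ.0≤∣p∣ p)

BinsEventuallyBelow : Algorithm → ℚ → ℕ → Set
BinsEventuallyBelow A β N₀ = ∀ s → ValidInput s → ∀ t k → IsOPT t (prefix t s) k → N₀ ≤ k →
  ℕ→ℚ (binsUsed t (packingAt A s t)) ℚ.≤ β ℚ.* ℕ→ℚ k

ratio⇒eventually-below : ∀ A α β → AsymRatioAtMost A α → α ℚ.< β → ∃ (BinsEventuallyBelow A β)
ratio⇒eventually-below A α β (f , f∈o[OPT] , ratio) α<β
  with f∈o[OPT] (β ℚ.- α) (subst (ℚ._< β ℚ.- α) (ℚ.+-inverseʳ α) (ℚ.+-monoˡ-< (ℚ.- α) α<β))
... | N₀ , f-small = N₀ , λ s valid t k opt N₀≤k → begin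
  ℕ→ℚ (binsUsed t (packingAt A s t))
    ≤⟨ ratio s valid t k opt ⟩
  α ℚ.* ℕ→ℚ k ℚ.+ f t (prefix t s)
    ≤⟨ ℚ.+-monoʳ-≤ (α ℚ.* ℕ→ℚ k) (ℚ.≤-trans (p≤∣p∣ _) (f-small t (prefix t s) (valid ∘ toℕ) k opt N₀≤k)) ⟩
  α ℚ.* ℕ→ℚ k ℚ.+ (β ℚ.- α) ℚ.* ℕ→ℚ k
    ≡⟨ solve 3 (λ α β k → α :* k :+ (β :- α) :* k := β :* k) refl α β (ℕ→ℚ k) ⟩
  β ℚ.* ℕ→ℚ k ∎
  where
  open ℚ.≤-Reasoning
  open ℚ-Solver

excess-bound : ∀ {a β u b l} → a + β * b ≤ l → l < a + suc u * b → β ≤ u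
excess-bound {a} {β} {u} {b} le lt =
  s≤s⁻¹ (*-cancelʳ-< b β (suc u) (+-cancelˡ-< a (β * b) (suc u * b) (≤-<-trans le lt)))

module HardInstance (c m : ℕ) where

  A B L : ℕ
  A = (3 + 4 * c) * suc c
  B = 5 + 4 * c
  L = A + suc c * B

  L<[2+2c]B : L < (2 + 2 * c) * B
  L<[2+2c]B = subst (L <_) (e c) (m<m+n L {2 + 2 * c} z<s)
    where
    e : ∀ c → ((3 + 4 * c) * suc c + suc c * (5 + 4 * c)) + (2 + 2 * c) ≡ (2 + 2 * c) * (5 + 4 * c)
    e = ℕ-Solver.solve-∀

  L<2A+B : L < 2 * A + 1 * B
  L<2A+B = subst (L <_) (e c) (m<m+n L {3 + 2 * c} z<s)
    where
    e : ∀ c → ((3 + 4 * c) * suc c + suc c * (5 + 4 * c)) + (3 + 2 * c) ≡ 2 * ((3 + 4 * c) * suc c) + 1 * (5 + 4 * c)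
    e = ℕ-Solver.solve-∀

  L<A+[2+c]B : L < 1 * A + (2 + c) * B
  L<A+[2+c]B = subst (L <_) (e c) (m<m+n L {B} z<s)
    where
    e : ∀ c → ((3 + 4 * c) * suc c + suc c * (5 + 4 * c)) + (5 + 4 * c) ≡ 1 * ((3 + 4 * c) * suc c) + (2 + c) * (5 + 4 * c)
    e = ℕ-Solver.solve-∀

  L<3A : L < 3 * A
  L<3A = subst (L <_) (e c) (m<m+n L {suc (c * B)} z<s)
    where
    e : ∀ c → ((3 + 4 * c) * suc c + suc c * (5 + 4 * c)) + suc (c * (5 + 4 * c)) ≡ 3 * ((3 + 4 * c) * suc c)
    e = ℕ-Solver.solve-∀

  2A≤L : 2 * A ≤ L
  2A≤L = subst (2 * A ≤_) (e c) (m≤m+n (2 * A) (2 + 2 * c))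
    where
    e : ∀ c → 2 * ((3 + 4 * c) * suc c) + (2 + 2 * c) ≡ (3 + 4 * c) * suc c + suc c * (5 + 4 * c)
    e = ℕ-Solver.solve-∀

  cB<A : c * B < A
  cB<A = subst (c * B <_) (e c) (m<m+n (c * B) {3 + 2 * c} z<s)
    where
    e : ∀ c → c * (5 + 4 * c) + (3 + 2 * c) ≡ (3 + 4 * c) * suc c
    e = ℕ-Solver.solve-∀

  small-count≤ : ∀ {β} → β * B ≤ L → β ≤ 1 + 2 * c
  small-count≤ β*B≤L = excess-bound {a = 0} β*B≤L L<[2+2c]B

  large-small-weight≤ : ∀ α β → α * A + β * B ≤ L → α * suc c + β ≤ 2 + 2 * c
  large-small-weight≤ 0 β load≤L = ≤-trans (small-count≤ load≤L) (n≤1+n _)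
  large-small-weight≤ 1 β load≤L = begin
    1 * suc c + β     ≤⟨ +-monoʳ-≤ (1 * suc c) (excess-bound load≤L L<A+[2+c]B) ⟩
    1 * suc c + suc c ≡⟨ e c ⟩
    2 + 2 * c         ∎
    where
    open ≤-Reasoning
    e : ∀ c → 1 * suc c + suc c ≡ 2 + 2 * c
    e = ℕ-Solver.solve-∀
  large-small-weight≤ 2 β load≤L = begin
    2 * suc c + β     ≤⟨ +-monoʳ-≤ (2 * suc c) (excess-bound {u = 0} load≤L L<2A+B) ⟩
    2 * suc c + 0     ≡⟨ e c ⟩
    2 + 2 * c         ∎
    where
    open ≤-Reasoning
    e : ∀ c → 2 * suc c + 0 ≡ 2 + 2 * c
    e = ℕ-Solver.solve-∀
  large-small-weight≤ (suc (suc (suc α))) β load≤L = ⊥-elim (<⇒≱ L<3A (begin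
    3 * A                       ≤⟨ *-monoˡ-≤ A {3} {3 + α} (m≤m+n 3 α) ⟩
    suc (suc (suc α)) * A       ≤⟨ m≤m+n _ (β * B) ⟩
    suc (suc (suc α)) * A + β * B ≤⟨ load≤L ⟩
    L                           ∎))
    where open ≤-Reasoning

  M N K T : ℕ
  M = suc m
  N = 2 * M
  K = suc c * N
  T = K + N

  isLarge isSmall : ℕ → ℕ
  isLarge n = if ⌊ n <? N ⌋ then 1 else 0
  isSmall n = if ⌊ n <? N ⌋ then 0 else 1

  size weight : ℕ → ℕ
  size   n = if ⌊ n <? N ⌋ then A else B
  weight n = if ⌊ n <? N ⌋ then suc c else 1

  s : InputSeq
  s n = ℕ→ℚ (size n) ℚ.* (ℤ.+ 1 / L)

  size≡ : ∀ n → size n ≡ isLarge n * A + isSmall n * B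
  size≡ n with n <? N
  ... | yes _ = sym (trans (+-identityʳ (1 * A)) (*-identityˡ A))
  ... | no  _ = sym (*-identityˡ B)

  weight≡ : ∀ n → weight n ≡ isLarge n * suc c + isSmall n * 1
  weight≡ n with n <? N
  ... | yes _ = sym (trans (+-identityʳ (1 * suc c)) (*-identityˡ (suc c)))
  ... | no  _ = refl

  if-<N : ∀ {n} (x y : ℕ) → n < N → (if ⌊ n <? N ⌋ then x else y) ≡ x
  if-<N {n} x y n<N with n <? N
  ... | yes _   = refl
  ... | no  n≮N = ⊥-elim (n≮N n<N)

  if-N+ : ∀ i (x y : ℕ) → (if ⌊ N + i <? N ⌋ then x else y) ≡ y
  if-N+ i x y with N + i <? N
  ... | yes N+i<N = ⊥-elim (m+n≮m N i N+i<N)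
  ... | no  _     = refl

  isLarge≢0⇒< : ∀ n → isLarge n ≢ 0 → n < N
  isLarge≢0⇒< n large≢0 with n <? N
  ... | yes n<N = n<N
  ... | no  _   = ⊥-elim (large≢0 refl)

  valid : ValidInput s
  valid n = ℚ.≤-<-trans (ℚ.≤-reflexive (sym (ℚ.*-zeroˡ (ℤ.+ 1 / L))))
              (ℚ.*-monoˡ-<-pos (ℤ.+ 1 / L) {{ℚ.positive (1/n-pos L)}} (ℕ→ℚ-mono-< (0<size n)))
          , ≤⇒ℕ→ℚ*1/n≤1 L (size≤L n)
    where
    0<size : ∀ n → 0 < size n
    0<size n with n <? N
    ... | yes _ = z<s
    ... | no  _ = z<s
    size≤L : ∀ n → size n ≤ L
    size≤L n with n <? N
    ... | yes _ = m≤m+n A (suc c * B)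
    ... | no  _ = ≤-trans (m≤n*m B (suc c)) (m≤n+m (suc c * B) A)

  feasible⇒load≤L : ∀ {t} {σ : Assignment t} → Feasible t (prefix t s) σ →
    ∀ b → loadℕ t (size ∘ toℕ) σ b ≤ L
  feasible⇒load≤L {t} {σ} feasible b =
    ℕ→ℚ*1/n≤1⇒≤ L (subst (ℚ._≤ 1ℚ) (load-ℕ→ℚ t (size ∘ toℕ) (ℤ.+ 1 / L) σ b) (feasible b))

  load≤L⇒feasible : ∀ {t} {σ : Assignment t} → (∀ b → loadℕ t (size ∘ toℕ) σ b ≤ L) →
    Feasible t (prefix t s) σ
  load≤L⇒feasible {t} {σ} load≤L b =
    subst (ℚ._≤ 1ℚ) (sym (load-ℕ→ℚ t (size ∘ toℕ) (ℤ.+ 1 / L) σ b)) (≤⇒ℕ→ℚ*1/n≤1 L (load≤L b))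

  module _ {t} (σ : Assignment t) (b : ℕ) where

    large small : ℕ
    large = loadℕ t (isLarge ∘ toℕ) σ b
    small = loadℕ t (isSmall ∘ toℕ) σ b

    load≡ : loadℕ t (size ∘ toℕ) σ b ≡ large * A + small * B
    load≡ = loadℕ-linear A B σ b (size≡ ∘ toℕ)

    bin-weight≡ : loadℕ t (weight ∘ toℕ) σ b ≡ large * suc c + small
    bin-weight≡ = trans (loadℕ-linear (suc c) 1 σ b (weight≡ ∘ toℕ)) (cong (large * suc c +_) (*-identityʳ small))

  bin-weight≤ : ∀ {t} {σ : Assignment t} → Feasible t (prefix t s) σ →
    ∀ b → loadℕ t (weight ∘ toℕ) σ b ≤ 2 + 2 * c
  bin-weight≤ {t} {σ} feasible b = subst (_≤ 2 + 2 * c) (sym (bin-weight≡ {t} σ b))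
    (large-small-weight≤ (large σ b) (small σ b) (subst (_≤ L) (load≡ {t} σ b) (feasible⇒load≤L {t} {σ} feasible b)))

  weight-bound : ∀ {t k} → PackableIn t (prefix t s) k → ∑[ j < t ] weight (toℕ j) ≤ k * (2 + 2 * c)
  weight-bound {t} (σ , feasible) =
    ∑≤bins*capacity (weight ∘ toℕ) σ (2 + 2 * c) (bin-weight≤ {t} {toℕ ∘ σ} feasible)

  ∑weight-N : ∑[ j < N ] weight (toℕ j) ≡ M * (2 + 2 * c)
  ∑weight-N = trans (∑-cong-< N (λ _ n<N → if-<N (suc c) 1 n<N)) (trans (∑-const N (suc c)) (e M c))
    where
    e : ∀ M c → 2 * M * suc c ≡ M * (2 + 2 * c)
    e = ℕ-Solver.solve-∀

  ∑weight-T : ∑[ j < T ] weight (toℕ j) ≡ N * (2 + 2 * c)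
  ∑weight-T = begin
    ∑[ j < K + N ] weight (toℕ j)
      ≡⟨ cong (λ t → ∑[ j < t ] weight (toℕ j)) (+-comm K N) ⟩
    ∑[ j < N + K ] weight (toℕ j)
      ≡⟨ ∑-split N K weight ⟩
    ∑[ j < N ] weight (toℕ j) + ∑[ j < K ] weight (N + toℕ j)
      ≡⟨ cong₂ _+_ (∑-cong-< N (λ _ n<N → if-<N (suc c) 1 n<N)) (sum-cong-≗ {K} (λ j → if-N+ (toℕ j) (suc c) 1)) ⟩
    ∑[ j < N ] suc c + ∑[ j < K ] 1
      ≡⟨ cong₂ _+_ (∑-const N (suc c)) (∑-const K 1) ⟩
    N * suc c + suc c * N * 1
      ≡⟨ e N c ⟩
    N * (2 + 2 * c) ∎
    where
    open ≡-Reasoning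
    e : ∀ N c → N * suc c + suc c * N * 1 ≡ N * (2 + 2 * c)
    e = ℕ-Solver.solve-∀

  opt-N : IsOPT N (prefix N s) M
  opt-N = packableIn-mod N M (prefix N s) (load≤L⇒feasible {N} {λ j → toℕ j % M} pairs≤L)
        , λ k packable → *-cancelʳ-≤ M k (2 + 2 * c) (subst (_≤ k * (2 + 2 * c)) ∑weight-N (weight-bound packable))
    where
    pairs≤L : ∀ b → loadℕ N (size ∘ toℕ) (λ j → toℕ j % M) b ≤ L
    pairs≤L b = begin
      ∑[ j < N ] select (toℕ j % M) b (size (toℕ j))
        ≡⟨ ∑-cong-< N (λ n n<N → cong (select (n % M) b) (if-<N A B n<N)) ⟩
      ∑[ j < 2 * M ] select (toℕ j % M) b A
        ≤⟨ ∑-select-mod≤ 2 M b A ⟩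
      2 * A
        ≤⟨ 2A≤L ⟩
      L ∎
      where open ≤-Reasoning

  opt-T : IsOPT T (prefix T s) N
  opt-T = packableIn-mod T N (prefix T s) (load≤L⇒feasible {T} {λ j → toℕ j % N} one-large≤L)
        , λ k packable → *-cancelʳ-≤ N k (2 + 2 * c) (subst (_≤ k * (2 + 2 * c)) ∑weight-T (weight-bound packable))
    where
    one-large≤L : ∀ b → loadℕ T (size ∘ toℕ) (λ j → toℕ j % N) b ≤ L
    one-large≤L b = begin
      ∑[ j < K + N ] select (toℕ j % N) b (size (toℕ j))
        ≡⟨ cong (λ t → ∑[ j < t ] select (toℕ j % N) b (size (toℕ j))) (+-comm K N) ⟩
      ∑[ j < N + K ] select (toℕ j % N) b (size (toℕ j))
        ≡⟨ ∑-split N K (λ n → select (n % N) b (size n)) ⟩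
      ∑[ j < N ] select (toℕ j % N) b (size (toℕ j)) + ∑[ j < K ] select ((N + toℕ j) % N) b (size (N + toℕ j))
        ≡⟨ cong₂ _+_ (∑-cong-< N (λ n n<N → cong (select (n % N) b) (if-<N A B n<N)))
                     (sum-cong-≗ {K} (λ j → cong (select ((N + toℕ j) % N) b) (if-N+ (toℕ j) A B))) ⟩
      ∑[ j < N ] select (toℕ j % N) b A + ∑[ j < K ] select ((N + toℕ j) % N) b B
        ≡⟨ cong (∑[ j < N ] select (toℕ j % N) b A +_) (∑-select-+%≡ K N b B) ⟩
      ∑[ j < N ] select (toℕ j % N) b A + ∑[ j < suc c * N ] select (toℕ j % N) b B
        ≤⟨ +-mono-≤ (∑-select-%≤ N b A) (∑-select-mod≤ (suc c) N b B) ⟩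
      L ∎
      where open ≤-Reasoning

  small-lighter : ∀ {γ} → γ ℚ.≤ ℕ→ℚ c → (j : Fin N) → ∀ i → γ ℚ.* s (i + N) ℚ.< s (toℕ j)
  small-lighter {γ} γ≤c j i = begin-strict
    γ ℚ.* s (i + N)                     ≤⟨ ℚ.*-monoʳ-≤-nonNeg (s (i + N)) {{ℚ.nonNegative (ℚ.<⇒≤ (proj₁ (valid (i + N))))}} γ≤c ⟩
    ℕ→ℚ c ℚ.* s (i + N)                 ≡⟨ cong (λ n → ℕ→ℚ c ℚ.* (ℕ→ℚ n ℚ.* r)) (trans (cong size (+-comm i N)) (if-N+ i A B)) ⟩
    ℕ→ℚ c ℚ.* (ℕ→ℚ B ℚ.* r)             ≡⟨ sym (ℚ.*-assoc (ℕ→ℚ c) (ℕ→ℚ B) r) ⟩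
    ℕ→ℚ c ℚ.* ℕ→ℚ B ℚ.* r               ≡⟨ cong (ℚ._* r) (sym (ℕ→ℚ-* c B)) ⟩
    ℕ→ℚ (c * B) ℚ.* r                   <⟨ ℚ.*-monoˡ-<-pos r {{ℚ.positive (1/n-pos L)}} (ℕ→ℚ-mono-< cB<A) ⟩
    ℕ→ℚ A ℚ.* r                         ≡⟨ cong (λ n → ℕ→ℚ n ℚ.* r) (sym (if-<N A B (toℕ<n j))) ⟩
    s (toℕ j)                           ∎
    where
    open ℚ.≤-Reasoning
    r : ℚ
    r = ℤ.+ 1 / L

  module _ (σ₁ : Assignment N) (σ : Assignment T) (frozen : ∀ j → σ (embed K j) ≡ σ₁ j) where

    large∈usedBins : ∀ j → toℕ j < N → σ j ∈ usedBins N σ₁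
    large∈usedBins j j<N = subst (_∈ usedBins N σ₁) σ₁j′≡σj (∈-usedBins σ₁ j′)
      where
      j′ : Fin N
      j′ = Fin.fromℕ< j<N
      σ₁j′≡σj : σ₁ j′ ≡ σ j
      σ₁j′≡σj = trans (sym (frozen j′)) (cong σ (toℕ-injective (trans (toℕ-embed K j′) (toℕ-fromℕ< j<N))))

    no-large-outside : ∀ b → b ∉ usedBins N σ₁ → large σ b ≡ 0
    no-large-outside b b∉ = loadℕ-zero {T} (isLarge ∘ toℕ) σ b apart
      where
      apart : ∀ j → isLarge (toℕ j) ≢ 0 → σ j ≢ b
      apart j large≢0 σj≡b = b∉ (subst (_∈ usedBins N σ₁) σj≡b (large∈usedBins j (isLarge≢0⇒< (toℕ j) large≢0)))

    bins-lower-bound : Feasible T (prefix T s) σ → N * (2 + 2 * c) ≤ (1 + 2 * c) * binsUsed T σ + binsUsed N σ₁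
    bins-lower-bound feasible = begin
      N * (2 + 2 * c)
        ≡⟨ sym ∑weight-T ⟩
      ∑[ j < T ] weight (toℕ j)
        ≤⟨ ∑≤∑capacity (weight ∘ toℕ) σ capacity (usedBins T σ) (λ j _ → ∈-usedBins σ j) weight≤capacity ⟩
      sum (map capacity (usedBins T σ))
        ≤⟨ ∑capacity≤ (1 + 2 * c) (usedBins N σ₁) (usedBins T σ) (deduplicate-! (map σ (allFin T))) ⟩
      (1 + 2 * c) * binsUsed T σ + binsUsed N σ₁ ∎
      where
      open ≤-Reasoning
      capacity : ℕ → ℕ
      capacity b = 1 + 2 * c + [ b ∈ usedBins N σ₁ ]
      weight≤capacity : ∀ b → loadℕ T (weight ∘ toℕ) σ b ≤ capacity b
      weight≤capacity b = ≤-+-[∈] (usedBins N σ₁) b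
        (subst (loadℕ T (weight ∘ toℕ) σ b ≤_) (+-comm 1 (1 + 2 * c)) (bin-weight≤ {T} {σ} feasible b))
        without-large
        where
        without-large : b ∉ usedBins N σ₁ → loadℕ T (weight ∘ toℕ) σ b ≤ 1 + 2 * c
        without-large b∉ = begin
          loadℕ T (weight ∘ toℕ) σ b     ≡⟨ bin-weight≡ {T} σ b ⟩
          large σ b * suc c + small σ b  ≡⟨ cong (λ α → α * suc c + small σ b) (no-large-outside b b∉) ⟩
          small σ b                      ≤⟨ small-count≤ (subst (_≤ L) small-load≡ (feasible⇒load≤L {T} {σ} feasible b)) ⟩
          1 + 2 * c                      ∎
          where
          small-load≡ : loadℕ T (size ∘ toℕ) σ b ≡ small σ b * B
          small-load≡ = trans (load≡ {T} σ b) (cong (λ α → α * A + small σ b * B) (no-large-outside b b∉))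

ratio-lower-bound : ∀ β c M N d d₁ → N ≡ 2 * M → 0 < M → N * (2 + 2 * c) ≤ (1 + 2 * c) * d + d₁ →
  ℕ→ℚ d₁ ℚ.≤ β ℚ.* ℕ→ℚ M → ℕ→ℚ d ℚ.≤ β ℚ.* ℕ→ℚ N →
  ℕ→ℚ (4 + 4 * c) ℚ.≤ β ℚ.* ℕ→ℚ (3 + 4 * c)
ratio-lower-bound β c M _ d d₁ refl 0<M count d₁≤ d≤ =
  ℚ.*-cancelʳ-≤-pos (ℕ→ℚ M) {{ℚ.positive (ℕ→ℚ-mono-< 0<M)}} (begin
    ℕ→ℚ (4 + 4 * c) ℚ.* ℕ→ℚ M                 ≡⟨ sym (ℕ→ℚ-* (4 + 4 * c) M) ⟩
    ℕ→ℚ ((4 + 4 * c) * M)                     ≡⟨ cong ℕ→ℚ (e₁ c M) ⟩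
    ℕ→ℚ (2 * M * (2 + 2 * c))                 ≤⟨ ℕ→ℚ-mono-≤ count ⟩
    ℕ→ℚ ((1 + 2 * c) * d + d₁)                ≡⟨ trans (ℕ→ℚ-+ ((1 + 2 * c) * d) d₁) (cong (ℚ._+ ℕ→ℚ d₁) (ℕ→ℚ-* (1 + 2 * c) d)) ⟩
    ℕ→ℚ (1 + 2 * c) ℚ.* ℕ→ℚ d ℚ.+ ℕ→ℚ d₁     ≤⟨ ℚ.+-mono-≤ (ℚ.*-monoˡ-≤-nonNeg (ℕ→ℚ (1 + 2 * c)) {{ℕ→ℚ-nonNeg (1 + 2 * c)}} d≤) d₁≤ ⟩
    ℕ→ℚ (1 + 2 * c) ℚ.* (β ℚ.* ℕ→ℚ (2 * M)) ℚ.+ β ℚ.* ℕ→ℚ M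
        ≡⟨ solve 4 (λ x β y z → x :* (β :* y) :+ β :* z := β :* (x :* y :+ z)) refl (ℕ→ℚ (1 + 2 * c)) β (ℕ→ℚ (2 * M)) (ℕ→ℚ M) ⟩
    β ℚ.* (ℕ→ℚ (1 + 2 * c) ℚ.* ℕ→ℚ (2 * M) ℚ.+ ℕ→ℚ M)
        ≡⟨ cong (β ℚ.*_) (sym (trans (ℕ→ℚ-+ ((1 + 2 * c) * (2 * M)) M) (cong (ℚ._+ ℕ→ℚ M) (ℕ→ℚ-* (1 + 2 * c) (2 * M))))) ⟩
    β ℚ.* ℕ→ℚ ((1 + 2 * c) * (2 * M) + M)     ≡⟨ cong (λ n → β ℚ.* ℕ→ℚ n) (e₂ c M) ⟩
    β ℚ.* ℕ→ℚ ((3 + 4 * c) * M)               ≡⟨ cong (β ℚ.*_) (ℕ→ℚ-* (3 + 4 * c) M) ⟩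
    β ℚ.* (ℕ→ℚ (3 + 4 * c) ℚ.* ℕ→ℚ M)         ≡⟨ sym (ℚ.*-assoc β (ℕ→ℚ (3 + 4 * c)) (ℕ→ℚ M)) ⟩
    β ℚ.* ℕ→ℚ (3 + 4 * c) ℚ.* ℕ→ℚ M           ∎)
  where
  open ℚ.≤-Reasoning
  open ℚ-Solver
  e₁ : ∀ c M → (4 + 4 * c) * M ≡ 2 * M * (2 + 2 * c)
  e₁ = ℕ-Solver.solve-∀
  e₂ : ∀ c M → (1 + 2 * c) * (2 * M) + M ≡ (3 + 4 * c) * M
  e₂ = ℕ-Solver.solve-∀

lowerBound*[3+4c]<4+4c : ∀ γ → lowerBound γ ℚ.* ℕ→ℚ (3 + 4 * ceilℕ γ) ℚ.< ℕ→ℚ (4 + 4 * ceilℕ γ)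
lowerBound*[3+4c]<4+4c γ = begin-strict
  (1ℚ ℚ.+ v) ℚ.* ℕ→ℚ (3 + 4 * c)
    ≡⟨ solve 2 (λ v q → (con 1ℚ :+ v) :* q := q :+ v :* q) refl v (ℕ→ℚ (3 + 4 * c)) ⟩
  ℕ→ℚ (3 + 4 * c) ℚ.+ v ℚ.* ℕ→ℚ (3 + 4 * c)
    <⟨ ℚ.+-monoʳ-< (ℕ→ℚ (3 + 4 * c)) (ℚ.*-monoʳ-<-pos v {{ℚ.positive (1/n-pos (5 + 6 * c))}} (ℕ→ℚ-mono-< 3+4c<5+6c)) ⟩
  ℕ→ℚ (3 + 4 * c) ℚ.+ v ℚ.* ℕ→ℚ (5 + 6 * c)
    ≡⟨ cong (ℕ→ℚ (3 + 4 * c) ℚ.+_) (trans (ℚ.*-comm v _) (ℕ→ℚ-*-inverse (5 + 6 * c))) ⟩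
  ℕ→ℚ (3 + 4 * c) ℚ.+ ℕ→ℚ 1
    ≡⟨ sym (ℕ→ℚ-+ (3 + 4 * c) 1) ⟩
  ℕ→ℚ (3 + 4 * c + 1)
    ≡⟨ cong ℕ→ℚ (+-comm (3 + 4 * c) 1) ⟩
  ℕ→ℚ (4 + 4 * c) ∎
  where
  open ℚ.≤-Reasoning
  open ℚ-Solver
  c : ℕ
  c = ceilℕ γ
  v : ℚ
  v = ℤ.+ 1 / (5 + 6 * c)
  3+4c<5+6c : 3 + 4 * c < 5 + 6 * c
  3+4c<5+6c = +-mono-≤ {4} {5} (n≤1+n 4) (*-monoˡ-≤ c {4} {6} (m≤m+n 4 2))

theorem1 : (γ : ℚ) → 0ℚ ℚ.< γ → (A : Algorithm) → HasMigrationFactor A γ →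
    (α : ℚ) → α ℚ.< lowerBound γ → ¬ AsymRatioAtMost A α
theorem1 γ _ alg migration-factor α α<bound ratio =
  refute (ratio⇒eventually-below alg α (lowerBound γ) ratio α<bound)
  where
  refute : ∃ (BinsEventuallyBelow alg (lowerBound γ)) → ⊥
  refute (N₀ , bins≤) = ℚ.<-irrefl refl (ℚ.<-≤-trans (lowerBound*[3+4c]<4+4c γ) forced)
    where
    open HardInstance (ceilℕ γ) N₀
    frozen : ∀ j → packingAt alg s T (embed K j) ≡ packingAt alg s N j
    frozen j = label-frozen alg valid γ (proj₂ (migration-factor s valid)) j (small-lighter (≤ceilℕ γ) j) K
    count : N * (2 + 2 * ceilℕ γ) ≤ (1 + 2 * ceilℕ γ) * binsUsed T (packingAt alg s T) + binsUsed N (packingAt alg s N)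
    count = bins-lower-bound (packingAt alg s N) (packingAt alg s T) frozen (proj₁ (migration-factor s valid) T)
    forced : ℕ→ℚ (4 + 4 * ceilℕ γ) ℚ.≤ lowerBound γ ℚ.* ℕ→ℚ (3 + 4 * ceilℕ γ)
    forced = ratio-lower-bound (lowerBound γ) (ceilℕ γ) M N (binsUsed T (packingAt alg s T)) (binsUsed N (packingAt alg s N)) refl z<s count
      (bins≤ s valid N M opt-N (n≤1+n N₀))
      (bins≤ s valid T N opt-T (≤-trans (n≤1+n N₀) (m≤m+n M (M + 0))))
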